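{- Let $G$ and $H$ be two nontrivial connected graphs, at least one of which is nonbipartite. If $diam(G)\leq2$, $diam(H)\leq2$, every edge of $G$ lies in a triangle of $G$ and every edge of $H$ lies in a triangle of $H$, then $pvc(G\times H)=spvc(G\times H)=1$; otherwise $pvc(G\times H)=2$.
   Context: All graphs are simple, finite and undirected; nontrivial means having at least two vertices. The direct product $G\times H$ has vertex set $V(G)\times V(H)$, with $(g,h)$ adjacent to $(g',h')$ iff $gg'\in E(G)$ and $hh'\in E(H)$. In a vertex-colored graph, a path is vertex-proper if any two adjacent internal vertices of the path receive different colors. $pvc(G)$ is the smallest number of colors in a vertex-coloring of a connected graph $G$ such that any two vertices are joined by a vertex-proper path, with $pvc(G)=0$ for complete $G$. A $u$-$v$ geodesic is a $u$-$v$ path of length $d(u,v)$; $spvc(G)$ is the smallest number of colors in a vertex-coloring such that any two vertices $u,v$ are joined by a vertex-proper $u$-$v$ geodesic, with $spvc(G)=0$ for complete $G$. -}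

module Defs where

open import Level using (0ℓ)
open import Data.Nat using (ℕ; zero; suc; _≤_; _<_)
open import Data.Fin using (Fin; zero; suc; toℕ; inject₁; fromℕ)
open import Data.Bool using (Bool)
open import Data.Product using (Σ; ∃; _×_; _,_; proj₁; proj₂)
open import Data.Product.Relation.Binary.Pointwise.NonDependent using ()
open import Relation.Nullary using (¬_; Dec)
open import Relation.Nullary.Decidable using (_×-dec_)
open import Relation.Binary using (Decidable)
open import Relation.Binary.PropositionalEquality using (_≡_; _≢_)
open import Function.Bundles using (_↔_)
open import Function.Definitions using (Injective)

record Graph : Set₁ where
  field
    V     : Set
    Adj   : V → V → Set
    adj?  : Decidable Adj
    sym   : ∀ {u v} → Adj u v → Adj v u
    irrefl : ∀ {u} → ¬ Adj u u
open Graph public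

Finite : Graph → Set
Finite G = Σ ℕ λ n → V G ↔ Fin n

Nontrivial : Graph → Set
Nontrivial G = Σ (V G) λ u → Σ (V G) λ v → u ≢ v

Complete : Graph → Set
Complete G = ∀ (u v : V G) → u ≢ v → Adj G u v

_⊗_ : Graph → Graph → Graph
G ⊗ H = record
  { V = V G × V H
  ; Adj = λ x y → Adj G (proj₁ x) (proj₁ y) × Adj H (proj₂ x) (proj₂ y)
  ; adj? = λ x y → adj? G (proj₁ x) (proj₁ y) ×-dec adj? H (proj₂ x) (proj₂ y)
  ; sym = λ { (a , b) → sym G a , sym H b }
  ; irrefl = λ { (a , b) → irrefl G a }
  }

record Walk (G : Graph) (u v : V G) (m : ℕ) : Set where
  field
    vtx   : Fin (suc m) → V G
    start : vtx zero ≡ u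
    end   : vtx (fromℕ m) ≡ v
    step  : ∀ (i : Fin m) → Adj G (vtx (inject₁ i)) (vtx (suc i))
open Walk public

IsPath : ∀ {G u v m} → Walk G u v m → Set
IsPath w = Injective _≡_ _≡_ (vtx w)

Connected : Graph → Set
Connected G = ∀ (u v : V G) → Σ ℕ λ m → Walk G u v m

DistLe : (G : Graph) → V G → V G → ℕ → Set
DistLe G u v k = Σ ℕ λ m → m ≤ k × Walk G u v m

DiamLe : Graph → ℕ → Set
DiamLe G k = ∀ (u v : V G) → DistLe G u v k

Bipartite : Graph → Set
Bipartite G = Σ (V G → Bool) λ f → ∀ {u v} → Adj G u v → f u ≢ f v

EdgesInTriangles : Graph → Set
EdgesInTriangles G = ∀ {u v} → Adj G u v → Σ (V G) λ w → Adj G u w × Adj G w v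

IsGeodesic : ∀ {G u v m} → Walk G u v m → Set
IsGeodesic {G} {u} {v} {m} w = ∀ m' → m' < m → ¬ Walk G u v m'

-- Vertex-proper: adjacent internal vertices (indices 1..m-1) get different colours.
VertexProper : ∀ {G u v m} {k : ℕ} → (V G → Fin k) → Walk G u v m → Set
VertexProper {m = m} c w =
  ∀ (i : Fin m) → 1 ≤ toℕ i → suc (toℕ i) < m →
    c (vtx w (inject₁ i)) ≢ c (vtx w (suc i))

PVColoring : (G : Graph) (k : ℕ) → (V G → Fin k) → Set
PVColoring G k c = ∀ (u v : V G) →
  Σ ℕ λ m → Σ (Walk G u v m) λ w → IsPath w × VertexProper c w

SPVColoring : (G : Graph) (k : ℕ) → (V G → Fin k) → Set
SPVColoring G k c = ∀ (u v : V G) →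
  Σ ℕ λ m → Σ (Walk G u v m) λ w → IsGeodesic w × VertexProper c w

-- "Least-number" predicate with the convention value 0 for complete graphs.
IsLeastColours : (G : Graph) → ((k : ℕ) → (V G → Fin k) → Set) → ℕ → Set
IsLeastColours G P k =
  (Complete G → k ≡ 0) ×
  (¬ Complete G →
     (Σ (V G → Fin k) (P k)) ×
     (∀ (k' : ℕ) (c : V G → Fin k') → P k' c → k ≤ k'))

PVC : Graph → ℕ → Set
PVC G = IsLeastColours G (PVColoring G)

SPVC : Graph → ℕ → Set
SPVC G = IsLeastColours G (SPVColoring G)

-- In a factor of diameter at most 2 whose edges all lie in triangles, any two vertices are joined
-- by a walk of length exactly 2 (a back-and-forth step, a detour through a triangle, or a shortest
-- walk); zipping such walks joins any two vertices of G × H by a geodesic of length at most 2,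
-- which is vertex-proper even with one colour. Conversely, with one colour a vertex-proper path has length
-- at most 2, and projecting these paths to the factors gives back the hypotheses.
--
-- For the value 2: a non-bipartite factor has walks of either parity between any two vertices,
-- and walks of equal parity in the two factors can be padded to equal length, so G × H is
-- connected. In a connected graph, colour each vertex by the parity of its distance to a root;
-- the path through a breadth-first-search tree from u up to a common ancestor and down to v then
-- alternates in colour.

module Submission where

open import Defs
open import Data.Nat using (ℕ; zero; suc; _+_; _*_; _≤_; _<_; z≤n; s≤s; s≤s⁻¹; s<s⁻¹; parity)
open import Data.Nat.Properties
open import Data.Parity using (Parity; 0ℙ; 1ℙ; _⁻¹) renaming (_+_ to _+ℙ_)
import Data.Parity.Properties as ℙ
open import Data.Fin using (Fin; zero; suc; inject₁; fromℕ)
import Data.Fin.Properties as Fin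
open import Data.Bool using (Bool; true; false)
open import Data.Product using (Σ; ∃; _,_; proj₁; proj₂; _×_)
import Data.Product.Properties as Σ
open import Data.Sum using (_⊎_; inj₁; inj₂; [_,_]′; map; map₁; map₂)
open import Data.Empty using (⊥-elim)
open import Data.Unit using (⊤; tt)
open import Function using (_∘_; id)
open import Function.Bundles using (Inverse; _↔_)
open import Function.Properties.Inverse using (↔⇒↣)
open import Relation.Nullary using (¬_; Dec; yes; no)
open import Relation.Nullary.Decidable using (map′; _×-dec_; via-injection)
open import Relation.Binary.Definitions using (DecidableEquality)
open import Relation.Binary.PropositionalEquality
  using (_≡_; _≢_; refl; cong; cong₂; subst; subst₂; trans; module ≡-Reasoning)
  renaming (sym to ≡-sym)

Searchable : Set → Set₁
Searchable A = ∀ {P : A → Set} → (∀ a → Dec (P a)) → Dec (∃ P)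

↔Fin⇒decEq : ∀ {A : Set} {n} → A ↔ Fin n → DecidableEquality A
↔Fin⇒decEq A↔Fin = via-injection (↔⇒↣ A↔Fin) Fin._≟_

↔Fin⇒searchable : ∀ {A : Set} {n} → A ↔ Fin n → Searchable A
↔Fin⇒searchable A↔Fin {P} P? =
  map′ (λ (i , p) → from i , p) (λ (x , p) → to x , subst P (≡-sym (strictlyInverseʳ x)) p)
       (Fin.any? (P? ∘ from))
  where open Inverse A↔Fin

×-searchable : ∀ {A B} → Searchable A → Searchable B → Searchable (A × B)
×-searchable searchA searchB P? =
  map′ (λ (a , b , p) → (a , b) , p) (λ ((a , b) , p) → a , b , p)
       (searchA (λ a → searchB (λ b → P? (a , b))))

data Chain (G : Graph) : V G → V G → ℕ → Set where
  []  : ∀ {u} → Chain G u u 0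
  _∷_ : ∀ {u w v m} → Adj G u w → Chain G w v m → Chain G u v (suc m)

infixr 5 _∷_

module _ {G : Graph} where

  infixr 5 _++_
  infixl 5 _∷ʳ_

  vertexAt : ∀ {u v m} → Chain G u v m → Fin (suc m) → V G
  vertexAt {u} _ zero = u
  vertexAt (_ ∷ p) (suc i) = vertexAt p i

  toWalk : ∀ {u v m} → Chain G u v m → Walk G u v m
  toWalk p = record { vtx = vertexAt p ; start = refl ; end = end′ p ; step = step′ p }
    where
    end′ : ∀ {u v m} (p : Chain G u v m) → vertexAt p (fromℕ m) ≡ v
    end′ [] = refl
    end′ (_ ∷ p) = end′ p
    step′ : ∀ {u v m} (p : Chain G u v m) (i : Fin m) →
            Adj G (vertexAt p (inject₁ i)) (vertexAt p (suc i))
    step′ (a ∷ _) zero = a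
    step′ (_ ∷ p) (suc i) = step′ p i

  fromWalk : ∀ {u v m} → Walk G u v m → Chain G u v m
  fromWalk {m = m} w =
    subst₂ (λ u v → Chain G u v m) (start w) (end w) (fromVertices m (vtx w) (step w))
    where
    fromVertices : ∀ m (f : Fin (suc m) → V G) → (∀ i → Adj G (f (inject₁ i)) (f (suc i))) →
                   Chain G (f zero) (f (fromℕ m)) m
    fromVertices zero _ _ = []
    fromVertices (suc m) f adj = adj zero ∷ fromVertices m (f ∘ suc) (adj ∘ suc)

  chain₀⇒≡ : ∀ {u v} → Chain G u v 0 → u ≡ v
  chain₀⇒≡ [] = refl

  _++_ : ∀ {u w v m n} → Chain G u w m → Chain G w v n → Chain G u v (m + n)
  [] ++ q = q
  (a ∷ p) ++ q = a ∷ (p ++ q)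

  _∷ʳ_ : ∀ {u w v m} → Chain G u w m → Adj G w v → Chain G u v (suc m)
  [] ∷ʳ a = a ∷ []
  (b ∷ p) ∷ʳ a = b ∷ (p ∷ʳ a)

  reverse : ∀ {u v m} → Chain G u v m → Chain G v u m
  reverse [] = []
  reverse (a ∷ p) = reverse p ∷ʳ sym G a

  infix 4 _∈_
  _∈_ : ∀ {u v m} → V G → Chain G u v m → Set
  x ∈ [] {u} = x ≡ u
  x ∈ _∷_ {u} _ p = x ≡ u ⊎ x ∈ p

  vertexAt-∈ : ∀ {u v m} (p : Chain G u v m) i → vertexAt p i ∈ p
  vertexAt-∈ [] zero = refl
  vertexAt-∈ (_ ∷ _) zero = inj₁ refl
  vertexAt-∈ (_ ∷ p) (suc i) = inj₂ (vertexAt-∈ p i)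

  ∈-∷ʳ⁻ : ∀ {u w v m x} (p : Chain G u w m) (a : Adj G w v) →
          x ∈ p ∷ʳ a → x ∈ p ⊎ x ≡ v
  ∈-∷ʳ⁻ [] a (inj₁ x≡u) = inj₁ x≡u
  ∈-∷ʳ⁻ [] a (inj₂ x≡v) = inj₂ x≡v
  ∈-∷ʳ⁻ (b ∷ p) a (inj₁ x≡u) = inj₁ (inj₁ x≡u)
  ∈-∷ʳ⁻ (b ∷ p) a (inj₂ x∈) = map₁ inj₂ (∈-∷ʳ⁻ p a x∈)

  Distinct : ∀ {u v m} → Chain G u v m → Set
  Distinct [] = ⊤
  Distinct (_∷_ {u} _ p) = ¬ u ∈ p × Distinct p

  Distinct-∷ʳ : ∀ {u w v m} (p : Chain G u w m) (a : Adj G w v) →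
                ¬ v ∈ p → Distinct p → Distinct (p ∷ʳ a)
  Distinct-∷ʳ [] a v∉ _ = (λ u≡v → v∉ (≡-sym u≡v)) , tt
  Distinct-∷ʳ (b ∷ p) a v∉ (u∉ , dp) =
    [ u∉ , (λ u≡v → v∉ (inj₁ (≡-sym u≡v))) ]′ ∘ ∈-∷ʳ⁻ p a ,
    Distinct-∷ʳ p a (v∉ ∘ inj₂) dp

  Distinct⇒IsPath : ∀ {u v m} (p : Chain G u v m) → Distinct p → IsPath (toWalk p)
  Distinct⇒IsPath [] _ {zero} {zero} _ = refl
  Distinct⇒IsPath (_ ∷ _) _ {zero} {zero} _ = refl
  Distinct⇒IsPath (_ ∷ p) (u∉ , _) {zero} {suc j} e =
    ⊥-elim (u∉ (subst (_∈ p) (≡-sym e) (vertexAt-∈ p j)))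
  Distinct⇒IsPath (_ ∷ p) (u∉ , _) {suc i} {zero} e =
    ⊥-elim (u∉ (subst (_∈ p) e (vertexAt-∈ p i)))
  Distinct⇒IsPath (_ ∷ p) (_ , dp) {suc i} {suc j} e = cong suc (Distinct⇒IsPath p dp e)

  module _ {k : ℕ} (c : V G → Fin k) where

    Properly : ∀ {u v m} → Chain G u v m → Set
    Properly [] = ⊤
    Properly (_∷_ {u} {w} _ p) = c u ≢ c w × Properly p

    Properly-∷ʳ : ∀ {u w v m} (p : Chain G u w m) (a : Adj G w v) →
                  c w ≢ c v → Properly p → Properly (p ∷ʳ a)
    Properly-∷ʳ [] a cw≢cv _ = cw≢cv , tt
    Properly-∷ʳ (b ∷ p) a cw≢cv (cu≢cw , pp) = cu≢cw , Properly-∷ʳ p a cw≢cv pp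

    Properly⇒VertexProper : ∀ {u v m} (p : Chain G u v m) → Properly p →
                            VertexProper c (toWalk p)
    Properly⇒VertexProper p pp i _ _ = steps p pp i
      where
      steps : ∀ {u v m} (p : Chain G u v m) → Properly p → ∀ i →
              c (vertexAt p (inject₁ i)) ≢ c (vertexAt p (suc i))
      steps (_ ∷ _) (cu≢cw , _) zero = cu≢cw
      steps (_ ∷ p) (_ , pp) (suc i) = steps p pp i

-- Parity colourings of breadth-first-search trees

parityColour : Parity → Fin 2
parityColour 0ℙ = zero
parityColour 1ℙ = suc zero

parityColour-injective : ∀ {p q} → parityColour p ≡ parityColour q → p ≡ q
parityColour-injective {0ℙ} {0ℙ} _ = refl
parityColour-injective {1ℙ} {1ℙ} _ = refl

parity-suc : ∀ n → parity (suc n) ≡ parity n ⁻¹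
parity-suc n = ≡-sym (ℙ.⁻¹-selfInverse (ℙ.suc-homo-⁻¹ n))

parity-suc-injective : ∀ {a b} → parity (suc a) ≡ parity (suc b) → parity a ≡ parity b
parity-suc-injective {a} {b} e =
  ℙ.⁻¹-injective (trans (≡-sym (parity-suc a)) (trans e (parity-suc b)))

≢⇒⁻¹≡ : ∀ {p q} → p ≢ q → p ⁻¹ ≡ q
≢⇒⁻¹≡ {0ℙ} {0ℙ} p≢q = ⊥-elim (p≢q refl)
≢⇒⁻¹≡ {0ℙ} {1ℙ} _   = refl
≢⇒⁻¹≡ {1ℙ} {0ℙ} _   = refl
≢⇒⁻¹≡ {1ℙ} {1ℙ} p≢q = ⊥-elim (p≢q refl)

parity-suc≢ : ∀ n → parity (suc n) ≢ parity n
parity-suc≢ n e = ℙ.p≢p⁻¹ (parity n) (trans (≡-sym e) (parity-suc n))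

-- A breadth-first-search tree, given by the depth of each vertex and its parent.
record Layering (G : Graph) : Set where
  field
    depth         : V G → ℕ
    depth0-unique : ∀ {u v} → depth u ≡ 0 → depth v ≡ 0 → u ≡ v
    parent        : ∀ {v n} → depth v ≡ suc n → V G
    parent-adj    : ∀ {v n} (e : depth v ≡ suc n) → Adj G v (parent e)
    parent-depth  : ∀ {v n} (e : depth v ≡ suc n) → depth (parent e) ≡ n

module TreePaths {G : Graph} (L : Layering G) (_≟_ : DecidableEquality (V G)) where
  open Layering L

  colour : V G → Fin 2
  colour = parityColour ∘ parity ∘ depth

  colour-parent : ∀ {v n} (e : depth v ≡ suc n) → colour v ≢ colour (parent e)
  colour-parent {n = n} e c≡ rewrite parent-depth e | e = parity-suc≢ n (parityColour-injective c≡)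

  parent-depth< : ∀ {v n} (e : depth v ≡ suc n) → depth (parent e) < depth v
  parent-depth< {n = n} e rewrite parent-depth e | e = n<1+n n

  infix 4 _≼_
  data _≼_ (x : V G) : V G → Set where
    here  : x ≼ x
    there : ∀ {v n} (e : depth v ≡ suc n) → x ≼ parent e → x ≼ v

  ≼⇒depth≤ : ∀ {x v} → x ≼ v → depth x ≤ depth v
  ≼⇒depth≤ here = ≤-refl
  ≼⇒depth≤ (there e x≼w) = ≤-trans (≼⇒depth≤ x≼w) (<⇒≤ (parent-depth< e))

  ≼∧depth≥⇒≡ : ∀ {x v} → x ≼ v → depth v ≤ depth x → x ≡ v
  ≼∧depth≥⇒≡ here _ = refl
  ≼∧depth≥⇒≡ (there e x≼w) dv≤dx =
    ⊥-elim (<⇒≱ (≤-<-trans (≼⇒depth≤ x≼w) (parent-depth< e)) dv≤dx)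

  -- Every vertex of the path lies on the parent chain of an endpoint; this is what rules out
  -- repeated vertices when the path is extended by a parent edge.
  record TreePath (u v : V G) : Set where
    field
      {length}   : ℕ
      chain      : Chain G u v length
      distinct   : Distinct chain
      proper     : Properly colour chain
      onBranches : ∀ {x} → x ∈ chain → x ≼ u ⊎ x ≼ v

  trivialPath : ∀ {u} → TreePath u u
  trivialPath =
    record { chain = [] ; distinct = tt ; proper = tt ; onBranches = λ { refl → inj₁ here } }

  climb : ∀ {u v n} → u ≢ v → depth v ≤ depth u → (e : depth u ≡ suc n) →
          TreePath (parent e) v → TreePath u v
  climb {u} u≢v dv≤du e p = record
    { chain      = parent-adj e ∷ chain
    ; distinct   = u∉ , distinct
    ; proper     = colour-parent e , proper
    ; onBranches = λ { (inj₁ refl) → inj₁ here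
                     ; (inj₂ x∈)   → map₁ (there e) (onBranches x∈) }
    }
    where
    open TreePath p
    u∉ : ¬ u ∈ chain
    u∉ u∈ with onBranches u∈
    ... | inj₁ u≼parent = <⇒≱ (parent-depth< e) (≼⇒depth≤ u≼parent)
    ... | inj₂ u≼v      = u≢v (≼∧depth≥⇒≡ u≼v dv≤du)

  descend : ∀ {u v n} → depth u < depth v → (e : depth v ≡ suc n) →
            TreePath u (parent e) → TreePath u v
  descend {v = v} du<dv e p = record
    { chain      = chain ∷ʳ sym G (parent-adj e)
    ; distinct   = Distinct-∷ʳ chain _ v∉ distinct
    ; proper     = Properly-∷ʳ colour chain _ (colour-parent e ∘ ≡-sym) proper
    ; onBranches = [ map₂ (there e) ∘ onBranches , (λ { refl → inj₂ here }) ]′ ∘ ∈-∷ʳ⁻ chain _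
    }
    where
    open TreePath p
    v∉ : ¬ v ∈ chain
    v∉ v∈ with onBranches v∈
    ... | inj₁ v≼u      = <⇒≱ du<dv (≼⇒depth≤ v≼u)
    ... | inj₂ v≼parent = <⇒≱ (parent-depth< e) (≼⇒depth≤ v≼parent)

  treePath : ∀ fuel u v → depth u + depth v < fuel → TreePath u v
  treePath (suc fuel) u v bound with u ≟ v
  ... | yes refl = trivialPath
  ... | no u≢v with depth v ≤? depth u
  treePath (suc fuel) u v bound | no u≢v | yes dv≤du with depth u in e
  ... | zero  = ⊥-elim (u≢v (depth0-unique e (n≤0⇒n≡0 dv≤du)))
  ... | suc n = climb u≢v (subst (depth v ≤_) (≡-sym e) dv≤du) e (treePath fuel (parent e) v bound′)
    where
    bound′ : depth (parent e) + depth v < fuel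
    bound′ rewrite parent-depth e = s<s⁻¹ bound
  treePath (suc fuel) u v bound | no u≢v | no dv≰du with depth v in e
  ... | zero  = ⊥-elim (n≮0 (≰⇒> dv≰du))
  ... | suc n = descend (subst (depth u <_) (≡-sym e) (≰⇒> dv≰du)) e (treePath fuel u (parent e) bound′)
    where
    bound′ : depth u + depth (parent e) < fuel
    bound′ rewrite parent-depth e = s<s⁻¹ (subst (_< suc fuel) (+-suc (depth u) n) bound)

  colour-pvColouring : PVColoring G 2 colour
  colour-pvColouring u v =
    length , toWalk chain , Distinct⇒IsPath chain distinct , Properly⇒VertexProper colour chain proper
    where open TreePath (treePath (suc (depth u + depth v)) u v ≤-refl)

Minimal : (ℕ → Set) → Set
Minimal P = Σ ℕ λ n → P n × (∀ {k} → k < n → ¬ P k)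

minimal : ∀ {P : ℕ → Set} → (∀ n → Dec (P n)) → ∀ {n} → P n → Minimal P
minimal {P} P? {n} p = [ (λ none → ⊥-elim (none ≤-refl p)) , id ]′ (below (suc n))
  where
  below : ∀ n → (∀ {k} → k < n → ¬ P k) ⊎ Minimal P
  below zero = inj₁ λ ()
  below (suc n) with below n | P? n
  ... | inj₂ m    | _     = inj₂ m
  ... | inj₁ none | yes p = inj₂ (n , p , none)
  ... | inj₁ none | no ¬p = inj₁ ([ none , (λ { refl → ¬p }) ]′ ∘ m<1+n⇒m<n∨m≡n)

module _ {G : Graph} (_≟_ : DecidableEquality (V G)) (search : Searchable (V G)) where

  chain? : ∀ n u v → Dec (Chain G u v n)
  chain? zero u v = map′ (λ { refl → [] }) (λ { [] → refl }) (u ≟ v)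
  chain? (suc n) u v = map′ (λ (w , a , p) → a ∷ p) (λ { (a ∷ p) → _ , a , p })
                            (search (λ w → adj? G u w ×-dec chain? n w v))

  distanceLayering : (r : V G) → (∀ v → ∃ (Chain G v r)) → Layering G
  distanceLayering r reach = record
    { depth         = depth
    ; depth0-unique = λ du dv → trans (chain₀⇒≡ (geodesic⁰ du)) (≡-sym (chain₀⇒≡ (geodesic⁰ dv)))
    ; parent        = λ e → proj₁ (firstStep e)
    ; parent-adj    = λ e → proj₁ (proj₂ (firstStep e))
    ; parent-depth  = parent-depth
    }
    where
    closest : ∀ v → Minimal (Chain G v r)
    closest v = minimal (λ m → chain? m v r) (proj₂ (reach v))

    depth : V G → ℕ
    depth v = proj₁ (closest v)

    geodesic : ∀ v → Chain G v r (depth v)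
    geodesic v = proj₁ (proj₂ (closest v))

    depth-minimal : ∀ {v m} → Chain G v r m → depth v ≤ m
    depth-minimal {v} p = ≮⇒≥ (λ m<d → proj₂ (proj₂ (closest v)) m<d p)

    geodesic⁰ : ∀ {v} → depth v ≡ 0 → Chain G v r 0
    geodesic⁰ {v} e = subst (Chain G v r) e (geodesic v)

    firstStep : ∀ {v n} → depth v ≡ suc n → Σ (V G) λ w → Adj G v w × Chain G w r n
    firstStep {v} e with subst (Chain G v r) e (geodesic v)
    ... | a ∷ p = _ , a , p

    parent-depth : ∀ {v n} (e : depth v ≡ suc n) → depth (proj₁ (firstStep e)) ≡ n
    parent-depth {v} e with firstStep e
    ... | w , a , p =
      ≤-antisym (depth-minimal p) (s≤s⁻¹ (subst (_≤ suc (depth w)) e (depth-minimal (a ∷ geodesic w))))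

-- Connectivity of direct products

Reachable : Graph → Set
Reachable G = ∀ u v → ∃ (Chain G u v)

HasNeighbours : Graph → Set
HasNeighbours G = ∀ v → ∃ (Adj G v)

AllParities : Graph → Set
AllParities G = ∀ u v p → Σ ℕ λ m → Chain G u v m × parity m ≡ p

connected⇒reachable : ∀ {G} → Connected G → Reachable G
connected⇒reachable conn u v = proj₁ (conn u v) , fromWalk (proj₂ (conn u v))

chain⇒neighbour : ∀ {G u v m} → Chain G u v m → u ≢ v → ∃ (Adj G u)
chain⇒neighbour []      u≢u = ⊥-elim (u≢u refl)
chain⇒neighbour (a ∷ _) _   = _ , a

nontrivial⇒hasNeighbours : ∀ {G} → DecidableEquality (V G) → Nontrivial G → Reachable G →
                           HasNeighbours G
nontrivial⇒hasNeighbours _≟_ (u , v , u≢v) reach x with x ≟ u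
... | yes refl = chain⇒neighbour (proj₂ (reach x v)) u≢v
... | no x≢u   = chain⇒neighbour (proj₂ (reach x u)) x≢u

parity≡∧≤⇒+2k : ∀ {a b} → parity a ≡ parity b → a ≤ b → ∃ λ k → k * 2 + a ≡ b
parity≡∧≤⇒+2k {zero} {zero} _ _ = 0 , refl
parity≡∧≤⇒+2k {zero} {suc (suc b)} e _ with parity≡∧≤⇒+2k {zero} {b} e z≤n
... | k , k*2≡b = suc k , cong (2 +_) k*2≡b
parity≡∧≤⇒+2k {suc a} {suc b} e (s≤s a≤b)
  with parity≡∧≤⇒+2k (parity-suc-injective {a} {b} e) a≤b
... | k , k*2+a≡b = k , trans (+-suc (k * 2) a) (cong (1 +_) k*2+a≡b)

module _ {G : Graph} (nbr : HasNeighbours G) where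

  pad : ∀ k {u v m} → Chain G u v m → Chain G u v (k * 2 + m)
  pad zero p = p
  pad (suc k) {u} p = proj₂ (nbr u) ∷ sym G (proj₂ (nbr u)) ∷ pad k p

  lengthen : ∀ {u v a b} → parity a ≡ parity b → a ≤ b → Chain G u v a → Chain G u v b
  lengthen {u} {v} e a≤b p with parity≡∧≤⇒+2k e a≤b
  ... | k , k*2+a≡b = subst (Chain G u v) k*2+a≡b (pad k p)

module _ {G H : Graph} where

  zip : ∀ {g g′ h h′ m} → Chain G g g′ m → Chain H h h′ m →
        Chain (G ⊗ H) (g , h) (g′ , h′) m
  zip [] [] = []
  zip (a ∷ p) (b ∷ q) = (a , b) ∷ zip p q

  unzip₁ : ∀ {x y m} → Chain (G ⊗ H) x y m → Chain G (proj₁ x) (proj₁ y) m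
  unzip₁ [] = []
  unzip₁ (ab ∷ p) = proj₁ ab ∷ unzip₁ p

  ⊗-swap : ∀ {g g′ h h′ m} → Chain (G ⊗ H) (g , h) (g′ , h′) m →
           Chain (H ⊗ G) (h , g) (h′ , g′) m
  ⊗-swap [] = []
  ⊗-swap ((a , b) ∷ p) = (b , a) ∷ ⊗-swap p

  zip-parity : HasNeighbours G → HasNeighbours H → ∀ {g g′ h h′ a b} →
               Chain G g g′ a → Chain H h h′ b → parity a ≡ parity b →
               ∃ (Chain (G ⊗ H) (g , h) (g′ , h′))
  zip-parity nbrG nbrH {a = a} {b} p q e with ≤-total a b
  ... | inj₁ a≤b = b , zip (lengthen nbrG e a≤b p) q
  ... | inj₂ b≤a = a , zip p (lengthen nbrH (≡-sym e) b≤a q)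

  ⊗-reachable : HasNeighbours G → HasNeighbours H → Reachable G → Reachable H →
                AllParities G ⊎ AllParities H → Reachable (G ⊗ H)
  ⊗-reachable nbrG nbrH _ reachH (inj₁ parG) (g , h) (g′ , h′) =
    let b , q = reachH h h′ ; a , p , e = parG g g′ (parity b) in zip-parity nbrG nbrH p q e
  ⊗-reachable nbrG nbrH reachG _ (inj₂ parH) (g , h) (g′ , h′) =
    let a , p = reachG g g′ ; b , q , e = parH h h′ (parity a) in zip-parity nbrG nbrH p q (≡-sym e)

parityBool : Parity → Bool
parityBool 0ℙ = false
parityBool 1ℙ = true

parityBool-injective : ∀ {p q} → parityBool p ≡ parityBool q → p ≡ q
parityBool-injective {0ℙ} {0ℙ} _ = refl
parityBool-injective {1ℙ} {1ℙ} _ = refl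

module _ {G : Graph} (search : Searchable (V G)) (reach : Reachable G) (nonBip : ¬ Bipartite G) where

  module _ (r : V G) where

    private
      ℓ : V G → ℕ
      ℓ v = proj₁ (reach v r)

    -- If no edge joined two vertices whose fixed walks to r have equal parity,
    -- those parities would 2-colour G.
    oddClosedChain : Σ ℕ λ L → Chain G r r L × parity L ≡ 1ℙ
    oddClosedChain
      with search (λ u → search (λ v → adj? G u v ×-dec (parity (ℓ u) ℙ.≟ parity (ℓ v))))
    ... | no noBadEdge =
      ⊥-elim (nonBip (parityBool ∘ parity ∘ ℓ , λ a e → noBadEdge (_ , _ , a , parityBool-injective e)))
    ... | yes (u , v , a , e) =
      ℓ u + suc (ℓ v) , reverse (proj₂ (reach u r)) ++ (a ∷ proj₂ (reach v r)) , odd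
      where
      open ≡-Reasoning
      odd : parity (ℓ u + suc (ℓ v)) ≡ 1ℙ
      odd = begin
        parity (ℓ u + suc (ℓ v))           ≡⟨ ℙ.+-homo-+ (ℓ u) (suc (ℓ v)) ⟩
        parity (ℓ u) +ℙ parity (suc (ℓ v)) ≡⟨ cong₂ _+ℙ_ e (parity-suc (ℓ v)) ⟩
        parity (ℓ v) +ℙ parity (ℓ v) ⁻¹    ≡⟨ ℙ.p+p⁻¹≡1ℙ (parity (ℓ v)) ⟩
        1ℙ                                 ∎

  nonBipartite⇒allParities : AllParities G
  nonBipartite⇒allParities u v p with reach u v
  ... | a , q with parity a ℙ.≟ p
  ...   | yes e   = a , q , e
  ...   | no a≢p  with oddClosedChain u
  ...     | L , loop , odd = L + a , loop ++ q , parity-odd+a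
    where
    open ≡-Reasoning
    parity-odd+a : parity (L + a) ≡ p
    parity-odd+a = begin
      parity (L + a)          ≡⟨ ℙ.+-homo-+ L a ⟩
      parity L +ℙ parity a    ≡⟨ cong (_+ℙ parity a) odd ⟩
      parity a ⁻¹             ≡⟨ ≢⇒⁻¹≡ a≢p ⟩
      p                       ∎

⊗-connected : ∀ {G H} → Finite G → Finite H → Nontrivial G → Nontrivial H → Connected G → Connected H →
              ¬ Bipartite G ⊎ ¬ Bipartite H → Reachable (G ⊗ H)
⊗-connected {G} {H} (_ , G↔Fin) (_ , H↔Fin) ntG ntH connG connH nonBip =
  ⊗-reachable nbrG nbrH reachG reachH
    (map (nonBipartite⇒allParities (↔Fin⇒searchable G↔Fin) reachG)
         (nonBipartite⇒allParities (↔Fin⇒searchable H↔Fin) reachH) nonBip)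
  where
  reachG : Reachable G
  reachG = connected⇒reachable connG
  reachH : Reachable H
  reachH = connected⇒reachable connH
  nbrG : HasNeighbours G
  nbrG = nontrivial⇒hasNeighbours (↔Fin⇒decEq G↔Fin) ntG reachG
  nbrH : HasNeighbours H
  nbrH = nontrivial⇒hasNeighbours (↔Fin⇒decEq H↔Fin) ntH reachH

-- One colour

3+k≰2 : ∀ {k} → ¬ 3 + k ≤ 2
3+k≰2 (s≤s (s≤s ()))

≤2⇒VertexProper : ∀ {K u v m k} (c : V K → Fin k) (w : Walk K u v m) → m ≤ 2 →
                  VertexProper c w
≤2⇒VertexProper c w m≤2 i 1≤i i+1<m _ = <⇒≱ (≤-trans (s≤s (s≤s 1≤i)) i+1<m) m≤2

VertexProper₁⇒≤2 : ∀ {K u v} (c : V K → Fin 1) m (w : Walk K u v m) → VertexProper c w →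
                   m ≤ 2
VertexProper₁⇒≤2 c zero _ _ = z≤n
VertexProper₁⇒≤2 c (suc zero) _ _ = s≤s z≤n
VertexProper₁⇒≤2 c (suc (suc zero)) _ _ = ≤-refl
VertexProper₁⇒≤2 c (suc (suc (suc m))) w vp =
  ⊥-elim (vp (suc zero) ≤-refl (s≤s (s≤s (s≤s z≤n))) (Fin1-unique _ _))
  where
  Fin1-unique : (i j : Fin 1) → i ≡ j
  Fin1-unique zero zero = refl

Short : Graph → Set
Short K = ∀ u v → Σ ℕ λ m → m ≤ 2 × Chain K u v m

pvColouring₁⇒short : ∀ {K} (c : V K → Fin 1) → PVColoring K 1 c → Short K
pvColouring₁⇒short c pv u v with pv u v
... | m , w , _ , vp = m , VertexProper₁⇒≤2 c m w vp , fromWalk w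

⊗-short-swap : ∀ {G H} → Short (G ⊗ H) → Short (H ⊗ G)
⊗-short-swap {G} {H} short (h , g) (h′ , g′) with short (g , h) (g′ , h′)
... | m , m≤2 , p = m , m≤2 , ⊗-swap {G} {H} p

⊗-short⇒diam≤2 : ∀ {G H} → V H → Short (G ⊗ H) → DiamLe G 2
⊗-short⇒diam≤2 {G} {H} h short g g′ with short (g , h) (g′ , h)
... | m , m≤2 , p = m , m≤2 , toWalk (unzip₁ {G} {H} p)

-- (u , h) and (v , h) are distinct and non-adjacent, so the short chain between them has length 2.
⊗-short⇒edgesInTriangles : ∀ {G H} → V H → Short (G ⊗ H) → EdgesInTriangles G
⊗-short⇒edgesInTriangles {G} {H} h short {u} {v} uv with short (u , h) (v , h)
... | _ , _   , []              = ⊥-elim (irrefl G uv)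
... | _ , _   , (a ∷ [])        = ⊥-elim (irrefl H (proj₂ a))
... | _ , _   , (a ∷ b ∷ [])    = _ , proj₁ a , proj₁ b
... | _ , m≤2 , (_ ∷ _ ∷ _ ∷ _) = ⊥-elim (3+k≰2 m≤2)

⊗-short⇒conditions : ∀ {G H} → V G → V H → Short (G ⊗ H) →
                     DiamLe G 2 × DiamLe H 2 × EdgesInTriangles G × EdgesInTriangles H
⊗-short⇒conditions {G} {H} g h short =
  ⊗-short⇒diam≤2 {G} {H} h short , ⊗-short⇒diam≤2 {H} {G} g (⊗-short-swap {G} {H} short) ,
  ⊗-short⇒edgesInTriangles {G} {H} h short ,
  ⊗-short⇒edgesInTriangles {H} {G} g (⊗-short-swap {G} {H} short)

module _ {G : Graph} (nbr : HasNeighbours G) (diam : DiamLe G 2) (tri : EdgesInTriangles G) where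

  twoStepChain : ∀ u v → Chain G u v 2
  twoStepChain u v with diam u v
  ... | _ , m≤2 , w with fromWalk w
  ...   | []             = proj₂ (nbr u) ∷ sym G (proj₂ (nbr u)) ∷ []
  ...   | uv ∷ []        = proj₁ (proj₂ (tri uv)) ∷ proj₂ (proj₂ (tri uv)) ∷ []
  ...   | p@(_ ∷ _ ∷ []) = p
  ...   | _ ∷ _ ∷ _ ∷ _  = ⊥-elim (3+k≰2 m≤2)

walk₀⇒≡ : ∀ {K u v} → Walk K u v 0 → u ≡ v
walk₀⇒≡ = chain₀⇒≡ ∘ fromWalk

walk₁⇒Adj : ∀ {K u v} → Walk K u v 1 → Adj K u v
walk₁⇒Adj w with fromWalk w
... | uv ∷ [] = uv

ShortGeodesicPath : (K : Graph) → V K → V K → Set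
ShortGeodesicPath K u v =
  Σ ℕ λ m → m ≤ 2 × Σ (Chain K u v m) λ p → Distinct p × IsGeodesic (toWalk p)

twoStepChains⇒shortGeodesicPath : ∀ {K} → DecidableEquality (V K) → (∀ u v → Chain K u v 2) →
                                  ∀ u v → ShortGeodesicPath K u v
twoStepChains⇒shortGeodesicPath {K} _≟_ chain₂ u v with u ≟ v
... | yes refl = 0 , z≤n , [] , tt , λ _ ()
... | no u≢v with adj? K u v
...   | yes uv = 1 , s≤s z≤n , uv ∷ [] , (u≢v , tt) ,
                 λ { zero _ w → u≢v (walk₀⇒≡ w) ; (suc _) (s≤s ()) _ }
...   | no ¬uv with chain₂ u v
...     | uw ∷ wv ∷ [] = 2 , ≤-refl , uw ∷ wv ∷ [] , (u∉ , w∉ , tt) , geodesic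
  where
  u∉ : ¬ (u ≡ _ ⊎ u ≡ v)
  u∉ (inj₁ refl) = irrefl K uw
  u∉ (inj₂ u≡v)  = u≢v u≡v
  w∉ : ¬ _ ≡ v
  w∉ refl = irrefl K wv
  geodesic : IsGeodesic (toWalk (uw ∷ wv ∷ []))
  geodesic zero _ w = u≢v (walk₀⇒≡ w)
  geodesic (suc zero) _ w = ¬uv (walk₁⇒Adj w)
  geodesic (suc (suc _)) (s≤s (s≤s ())) _

⊗-shortGeodesicPath : ∀ {G H} → DecidableEquality (V G) → DecidableEquality (V H) →
                      HasNeighbours G → HasNeighbours H →
                      DiamLe G 2 × DiamLe H 2 × EdgesInTriangles G × EdgesInTriangles H →
                      ∀ x y → ShortGeodesicPath (G ⊗ H) x y
⊗-shortGeodesicPath {G} {H} decG decH nbrG nbrH (diamG , diamH , triG , triH) =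
  twoStepChains⇒shortGeodesicPath {G ⊗ H} (Σ.≡-dec decG decH) λ (g , h) (g′ , h′) →
    zip (twoStepChain nbrG diamG triG g g′) (twoStepChain nbrH diamH triH h h′)

isLeastColours-intro : ∀ K (Pr : (k : ℕ) → (V K → Fin k) → Set) {k} → ¬ Complete K →
                       Σ (V K → Fin k) (Pr k) → (∀ k′ c → Pr k′ c → k ≤ k′) → IsLeastColours K Pr k
isLeastColours-intro _ _ ¬complete colouring least = ⊥-elim ∘ ¬complete , λ _ → colouring , least

colours-positive : ∀ {K k} → V K → (V K → Fin k) → 1 ≤ k
colours-positive {k = zero} v c = ⊥-elim (Fin.¬Fin0 (c v))
colours-positive {k = suc k} _ _ = s≤s z≤n

shortGeodesicPaths⇒pvc≡1 : ∀ {K} → V K → ¬ Complete K → (∀ u v → ShortGeodesicPath K u v) →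
                           PVC K 1 × SPVC K 1
shortGeodesicPaths⇒pvc≡1 {K} v ¬complete geodesics =
  isLeastColours-intro K (PVColoring K) ¬complete (_ , pvColouring) (λ _ c _ → colours-positive {K} v c) ,
  isLeastColours-intro K (SPVColoring K) ¬complete (_ , spvColouring) (λ _ c _ → colours-positive {K} v c)
  where
  pvColouring : PVColoring K 1 (λ _ → zero)
  pvColouring u v with geodesics u v
  ... | m , m≤2 , p , dp , _ =
    m , toWalk p , Distinct⇒IsPath p dp , ≤2⇒VertexProper _ (toWalk p) m≤2

  spvColouring : SPVColoring K 1 (λ _ → zero)
  spvColouring u v with geodesics u v
  ... | m , m≤2 , p , _ , geo = m , toWalk p , geo , ≤2⇒VertexProper _ (toWalk p) m≤2

reachable⇒pvc≡2 : ∀ {K} → DecidableEquality (V K) → Searchable (V K) → Reachable K → V K →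
                  ¬ Complete K → (∀ c → ¬ PVColoring K 1 c) → PVC K 2
reachable⇒pvc≡2 {K} decK searchK reachK r ¬complete no1Colouring =
  isLeastColours-intro K (PVColoring K) ¬complete (colour , colour-pvColouring) atLeastTwo
  where
  open TreePaths (distanceLayering decK searchK r (λ v → reachK v r)) decK
  atLeastTwo : ∀ k c → PVColoring K k c → 2 ≤ k
  atLeastTwo zero c _ = ⊥-elim (Fin.¬Fin0 (c r))
  atLeastTwo (suc zero) c pv = ⊥-elim (no1Colouring c pv)
  atLeastTwo (suc (suc k)) _ _ = s≤s (s≤s z≤n)

⊗-notComplete : ∀ {G H} → V G → Nontrivial H → ¬ Complete (G ⊗ H)
⊗-notComplete {G} g (h , h′ , h≢h′) complete =
  irrefl G (proj₁ (complete (g , h) (g , h′) (h≢h′ ∘ cong proj₂)))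

theorem6p3 : (G H : Graph) →
    Finite G → Finite H →
    Nontrivial G → Nontrivial H →
    Connected G → Connected H →
    (¬ Bipartite G ⊎ ¬ Bipartite H) →
    ((DiamLe G 2 × DiamLe H 2 × EdgesInTriangles G × EdgesInTriangles H) →
       PVC (G ⊗ H) 1 × SPVC (G ⊗ H) 1) ×
    (¬ (DiamLe G 2 × DiamLe H 2 × EdgesInTriangles G × EdgesInTriangles H) →
       PVC (G ⊗ H) 2)
theorem6p3 G H finG@(_ , G↔Fin) finH@(_ , H↔Fin) ntG@(g₀ , _) ntH@(h₀ , _) connG connH nonBip =
  (λ conditions → shortGeodesicPaths⇒pvc≡1 (g₀ , h₀) ¬complete
                    (⊗-shortGeodesicPath decG decH nbrG nbrH conditions)) ,
  (λ ¬conditions → reachable⇒pvc≡2 (Σ.≡-dec decG decH)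
                     (×-searchable (↔Fin⇒searchable G↔Fin) (↔Fin⇒searchable H↔Fin))
                     (⊗-connected finG finH ntG ntH connG connH nonBip) (g₀ , h₀) ¬complete
                     (λ c → ¬conditions ∘ ⊗-short⇒conditions {G} {H} g₀ h₀ ∘ pvColouring₁⇒short c))
  where
  decG : DecidableEquality (V G)
  decG = ↔Fin⇒decEq G↔Fin
  decH : DecidableEquality (V H)
  decH = ↔Fin⇒decEq H↔Fin
  nbrG : HasNeighbours G
  nbrG = nontrivial⇒hasNeighbours decG ntG (connected⇒reachable connG)
  nbrH : HasNeighbours H
  nbrH = nontrivial⇒hasNeighbours decH ntH (connected⇒reachable connH)
  ¬complete : ¬ Complete (G ⊗ H)
  ¬complete = ⊗-notComplete {G} {H} g₀ ntH
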